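{- Let $s$ and $t$ be codes of the calculus $\lambda^{hc}$, both in normal form, with $s \neq t$. Then there do not exist contexts $\Delta,\Gamma$, a trail $q$ and a type $A$ such that $\Delta;\Gamma \vdash q : s \mathrel{\overset{\triangleright}{=}}_A t$.
   Context: The calculus $\lambda^{hc}$ (codes and trails). There are two disjoint countable sets of variables: simple variables $a,b,\dots$ and audited variables $u,v,\dots$. Inspection labels are the symbols $\psi\in\{\mathsf{refl},\mathsf{trans},\beta,\beta_\Box,\mathsf{ti},\mathsf{lam},\mathsf{app},\mathsf{let},\mathsf{trpl}_{[]},\mathsf{trpl}_{::},\mathsf{d}\}$. Types, codes and trails are defined mutually: types $A,B,C ::= P \mid A\supset B \mid [\![s]\!]A$ ($P$ ranges over atomic types, $s$ over codes); codes $s,t,r ::= a \mid u \mid \lambda a^A.s \mid (s\,t) \mid\ !s \mid \mathsf{let}(u^A:=s,t) \mid \mathsf{TI}(\theta)$, where $\theta$ is a finite map from labels to codes; trails $q ::= \mathsf{refl}(s) \mid \mathsf{trans}(q,q') \mid \beta(a^A.s,t) \mid \beta_\Box(s,u^A.t) \mid \mathsf{ti}(q,\theta) \mid \mathsf{lam}(a^A.q) \mid \mathsf{app}(q,q') \mid \mathsf{let}(q,u^A.q') \mid \mathsf{trpl}(\zeta)$, where $\zeta$ is a finite ordered map from labels to trails. In $\lambda a^A.s$, $a$ is bound in $s$; in $\mathsf{let}(u^A:=s,t)$, $u$ is bound in $t$; in trails a variable before a dot is bound after the dot; everything is up to $\alpha$-equivalence. Substitution $s[t/a]$ of a code for a simple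 variable is capture-avoiding, acts pointwise on $\theta$ in $\mathsf{TI}(\theta)$, and does not enter boxes: $(!s)[t/a]=\,!s$. Substitution $s[t/u]$ for an audited variable is capture-avoiding and acts everywhere, including $(!s)[t/u]=\,!(s[t/u])$. Both extend to types and trails by acting on every code they contain. For a trail $q$ and a finite map $\theta$ from labels to codes, the code $q\theta$ is defined by recursion on $q$: if the head label of $q$ (its constructor name, where $\mathsf{trpl}(\zeta)$ has label $\mathsf{trpl}_{[]}$ if $\zeta$ is empty and $\mathsf{trpl}_{::}$ otherwise) is not in $\mathrm{dom}(\theta)$, then $q\theta=\theta(\mathsf{d})$; otherwise $\mathsf{refl}(\_)\theta=\theta(\mathsf{refl})$, $\beta(\_,\_)\theta=\theta(\beta)$, $\beta_\Box(\_,\_)\theta=\theta(\beta_\Box)$, $\mathsf{ti}(\_,\_)\theta=\theta(\mathsf{ti})$, $\mathsf{trans}(q_1,q_2)\theta=\theta(\mathsf{trans})\,(q_1\theta)\,(q_2\theta)$, $\mathsf{app}(q_1,q_2)\theta=\theta(\mathsf{app})\,(q_1\theta)\,(q_2\theta)$, $\mathsf{let}(q_1,u^A.q_2)\theta=\theta(\mathsf{let})\,(q_1\theta)\,(q_2\theta)$, $\mathsf{lam}(a^A.q_1)\theta=\theta(\mathsf{lam})\,(q_1\theta)$, $\mathsf{trpl}(\{\})\theta=\theta(\mathsf{trpl}_{[]})$, $\mathsf{trpl}(\{q_1/\psi_1,\vec{q'/\psi'}\})\theta=\theta(\mathsf{trpl}_{::})\,(q_1\theta)\,(\mathsf{trpl}(\{\vec{q'/\psi'}\})\theta)$.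 Source and target: $\mathrm{src}(\mathsf{refl}(s))=\mathrm{tgt}(\mathsf{refl}(s))=s$; $\mathrm{src}(\mathsf{trans}(q_1,q_2))=\mathrm{src}(q_1)$, $\mathrm{tgt}(\mathsf{trans}(q_1,q_2))=\mathrm{tgt}(q_2)$; $\mathrm{src}(\beta(a^A.s,t))=(\lambda a^A.s)\,t$, $\mathrm{tgt}=s[t/a]$; $\mathrm{src}(\beta_\Box(s,u^A.t))=\mathsf{let}(u^A:=\,!s,t)$, $\mathrm{tgt}=t[s/u]$; $\mathrm{src}(\mathsf{ti}(q,\theta))=\mathsf{TI}(\theta)$, $\mathrm{tgt}=q\theta$; and $\mathrm{src},\mathrm{tgt}$ commute with congruences: $\mathrm{src}(\mathsf{lam}(a^A.q))=\lambda a^A.\mathrm{src}(q)$, $\mathrm{src}(\mathsf{app}(q_1,q_2))=\mathrm{src}(q_1)\,\mathrm{src}(q_2)$, $\mathrm{src}(\mathsf{let}(q_1,u^A.q_2))=\mathsf{let}(u^A:=\mathrm{src}(q_1),\mathrm{src}(q_2))$, $\mathrm{src}(\mathsf{trpl}(\zeta))=\mathsf{TI}(\mathrm{src}\circ\zeta)$, and likewise for $\mathrm{tgt}$. For a type $B$: $\mathcal T^B(\psi)=B$ for $\psi\in\{\mathsf{d},\mathsf{refl},\beta,\beta_\Box,\mathsf{ti},\mathsf{trpl}_{[]}\}$; $\mathcal T^B(\mathsf{lam})=B\supset B$; $\mathcal T^B(\psi)=B\supset B\supset B$ for $\psi\in\{\mathsf{trans},\mathsf{app},\mathsf{let},\mathsf{trpl}_{::}\}$.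 $\Gamma$ is a list of declarations $a:A$, $\Delta$ a list of declarations $u::A$, $\cdot$ is the empty list. Code typing $\Delta;\Gamma\vdash s:A$: $a:A\in\Gamma \Rightarrow \Delta;\Gamma\vdash a:A$; $u::A\in\Delta\Rightarrow\Delta;\Gamma\vdash u:A$; $\Delta;\Gamma,a:A\vdash s:B\Rightarrow \Delta;\Gamma\vdash\lambda a^A.s:A\supset B$; $\Delta;\Gamma\vdash s:A\supset B$ and $\Delta;\Gamma\vdash t:A\Rightarrow\Delta;\Gamma\vdash s\,t:B$; $\Delta;\cdot\vdash t:A\Rightarrow \Delta;\Gamma\vdash\,!t:[\![t]\!]A$; $\Delta;\Gamma\vdash s:[\![r]\!]A$ and $\Delta,u::A;\Gamma\vdash t:C \Rightarrow \Delta;\Gamma\vdash\mathsf{let}(u^A:=s,t):C[r/u]$; $\mathsf{d}\in\mathrm{dom}(\theta)$ and $\Delta;\cdot\vdash\theta(\psi):\mathcal T^B(\psi)$ for all $\psi\in\mathrm{dom}(\theta)$ $\Rightarrow\Delta;\Gamma\vdash\mathsf{TI}(\theta):B$. Trail typing $\Delta;\Gamma\vdash q: s\mathrel{\overset{\triangleright}{=}}_A t$: $\Delta;\Gamma\vdash s:A\Rightarrow \mathsf{refl}(s): s\mathrel{\overset{\triangleright}{=}}_A s$; $q_1:r\mathrel{\overset{\triangleright}{=}}_A s$ and $q_2:s\mathrel{\overset{\triangleright}{=}}_A t\Rightarrow\mathsf{trans}(q_1,q_2):r\mathrel{\overset{\triangleright}{=}}_A t$; $\Delta;\Gamma,a:A\vdash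 s:B$ and $\Delta;\Gamma\vdash t:A\Rightarrow \beta(a^A.s,t):(\lambda a^A.s)\,t\mathrel{\overset{\triangleright}{=}}_B s[t/a]$; $\Delta;\cdot\vdash s:A$ and $\Delta,u::A;\Gamma\vdash t:C\Rightarrow \beta_\Box(s,u^A.t):\mathsf{let}(u^A:=\,!s,t)\mathrel{\overset{\triangleright}{=}}_{C[s/u]} t[s/u]$; $\mathsf{d}\in\mathrm{dom}(\theta)$, $\Delta;\cdot\vdash q:s\mathrel{\overset{\triangleright}{=}}_A t$ and $\Delta;\cdot\vdash\theta(\psi):\mathcal T^B(\psi)$ for all $\psi\in\mathrm{dom}(\theta)$ $\Rightarrow \mathsf{ti}(q,\theta):\mathsf{TI}(\theta)\mathrel{\overset{\triangleright}{=}}_B q\theta$; $\Delta;\Gamma,a:A\vdash q:s\mathrel{\overset{\triangleright}{=}}_B t\Rightarrow\mathsf{lam}(a^A.q):\lambda a^A.s\mathrel{\overset{\triangleright}{=}}_{A\supset B}\lambda a^A.t$; $q_1:s_1\mathrel{\overset{\triangleright}{=}}_{A\supset B}t_1$ and $q_2:s_2\mathrel{\overset{\triangleright}{=}}_A t_2\Rightarrow \mathsf{app}(q_1,q_2):s_1\,s_2\mathrel{\overset{\triangleright}{=}}_B t_1\,t_2$; $\Delta;\Gamma\vdash q_1:s_1\mathrel{\overset{\triangleright}{=}}_{[\![r]\!]A}t_1$ and $\Delta,u::A;\Gamma\vdash q_2:s_2\mathrel{\overset{\triangleright}{=}}_C t_2\Rightarrow\mathsf{let}(q_1,u^A.q_2):\mathsf{let}(u^A:=s_1,s_2)\mathrel{\overset{\triangleright}{=}}_{C[r/u]}\mathsf{let}(u^A:=t_1,t_2)$;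 $\mathsf{d}\in\mathrm{dom}(\zeta)$, $\mathrm{dom}(\zeta)=\mathrm{dom}(\theta)=\mathrm{dom}(\theta')$ and $\Delta;\cdot\vdash\zeta(\psi):\theta(\psi)\mathrel{\overset{\triangleright}{=}}_{\mathcal T^B(\psi)}\theta'(\psi)$ for all $\psi\in\mathrm{dom}(\zeta)$ $\Rightarrow\mathsf{trpl}(\zeta):\mathsf{TI}(\theta)\mathrel{\overset{\triangleright}{=}}_B\mathsf{TI}(\theta')$ (unless stated, all judgments in a rule share the same $\Delta;\Gamma$). Normal form: write $s\leadsto t$ if there is a well-typed trail $q$ (i.e. $\Delta;\Gamma\vdash q:s'\mathrel{\overset{\triangleright}{=}}_A t'$ for some $\Delta,\Gamma,A,s',t'$) with $\mathrm{src}(q)=s$ and $\mathrm{tgt}(q)=t$. A code $s$ is in normal form iff there is no $t\neq s$ with $s\leadsto t$. -}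

module Defs where

-- Simple and audited variables are two separate de Bruijn index sorts, so
-- syntactic equality (_≡_) of codes is α-equivalence.

open import Data.Nat using (ℕ; zero; suc; _+_; _<ᵇ_; _≡ᵇ_; pred)
open import Data.Bool using (Bool; true; false; if_then_else_)
open import Data.Maybe using (Maybe; just; nothing; fromMaybe)
open import Data.List using (List; []; _∷_; map)
open import Data.Product using (_×_; _,_; proj₁; Σ; ∃)
open import Data.List.Relation.Unary.Unique.Propositional using (Unique)
open import Relation.Binary.PropositionalEquality using (_≡_; _≢_)
open import Relation.Nullary using (¬_)

data Label : Set where
  ψrefl ψtrans ψβ ψβ□ ψti ψlam ψapp ψlet ψtrpl[] ψtrpl∷ ψd : Label

labelIdx : Label → ℕ
labelIdx ψrefl = 0
labelIdx ψtrans = 1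
labelIdx ψβ = 2
labelIdx ψβ□ = 3
labelIdx ψti = 4
labelIdx ψlam = 5
labelIdx ψapp = 6
labelIdx ψlet = 7
labelIdx ψtrpl[] = 8
labelIdx ψtrpl∷ = 9
labelIdx ψd = 10

data LMap (X : Set) : Set where
  lmap : (mrefl mtrans mβ mβ□ mti mlam mapp mlet mnil mcons md : Maybe X) → LMap X

_⟨_⟩ : {X : Set} → LMap X → Label → Maybe X
lmap a _ _ _ _ _ _ _ _ _ _ ⟨ ψrefl ⟩ = a
lmap _ a _ _ _ _ _ _ _ _ _ ⟨ ψtrans ⟩ = a
lmap _ _ a _ _ _ _ _ _ _ _ ⟨ ψβ ⟩ = a
lmap _ _ _ a _ _ _ _ _ _ _ ⟨ ψβ□ ⟩ = a
lmap _ _ _ _ a _ _ _ _ _ _ ⟨ ψti ⟩ = a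
lmap _ _ _ _ _ a _ _ _ _ _ ⟨ ψlam ⟩ = a
lmap _ _ _ _ _ _ a _ _ _ _ ⟨ ψapp ⟩ = a
lmap _ _ _ _ _ _ _ a _ _ _ ⟨ ψlet ⟩ = a
lmap _ _ _ _ _ _ _ _ a _ _ ⟨ ψtrpl[] ⟩ = a
lmap _ _ _ _ _ _ _ _ _ a _ ⟨ ψtrpl∷ ⟩ = a
lmap _ _ _ _ _ _ _ _ _ _ a ⟨ ψd ⟩ = a

emptyL : {X : Set} → LMap X
emptyL = lmap nothing nothing nothing nothing nothing nothing nothing nothing nothing nothing nothing

setL : {X : Set} → Label → X → LMap X → LMap X
setL ψrefl x (lmap a b c d e f g h i j k) = lmap (just x) b c d e f g h i j k
setL ψtrans x (lmap a b c d e f g h i j k) = lmap a (just x) c d e f g h i j k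
setL ψβ x (lmap a b c d e f g h i j k) = lmap a b (just x) d e f g h i j k
setL ψβ□ x (lmap a b c d e f g h i j k) = lmap a b c (just x) e f g h i j k
setL ψti x (lmap a b c d e f g h i j k) = lmap a b c d (just x) f g h i j k
setL ψlam x (lmap a b c d e f g h i j k) = lmap a b c d e (just x) g h i j k
setL ψapp x (lmap a b c d e f g h i j k) = lmap a b c d e f (just x) h i j k
setL ψlet x (lmap a b c d e f g h i j k) = lmap a b c d e f g (just x) i j k
setL ψtrpl[] x (lmap a b c d e f g h i j k) = lmap a b c d e f g h (just x) j k
setL ψtrpl∷ x (lmap a b c d e f g h i j k) = lmap a b c d e f g h i (just x) k
setL ψd x (lmap a b c d e f g h i j k) = lmap a b c d e f g h i j (just x)

infixr 5 _⊃_
mutual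
  data Ty : Set where
    atom : ℕ → Ty
    _⊃_  : Ty → Ty → Ty
    ⟦_⟧_ : Code → Ty → Ty

  data Code : Set where
    svar : ℕ → Code
    avar : ℕ → Code
    lam  : Ty → Code → Code         -- λ a^A . s   (binds a simple variable)
    app  : Code → Code → Code
    box  : Code → Code
    letB : Ty → Code → Code → Code  -- let(u^A := s , t)  (binds an audited variable in t)
    TI   : LMap Code → Code

-- Trails.  ζ (finite ordered map) is a list of (label , trail) pairs;
-- distinctness of its keys is imposed in the typing rule for trpl.
data Trail : Set where
  tRefl  : Code → Trail
  tTrans : Trail → Trail → Trail
  tβ     : Ty → Code → Code → Trail
  tβ□    : Code → Ty → Code → Trail
  tTi    : Trail → LMap Code → Trail
  tLam   : Ty → Trail → Trail
  tApp   : Trail → Trail → Trail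
  tLet   : Trail → Ty → Trail → Trail
  tTrpl  : List (Label × Trail) → Trail

-- Generic traversal of codes/types.  An action gets the number of simple
-- and audited binders passed and the variable index.  Inside a box the
-- action for simple variables is switched to `vb`.

Act : Set
Act = ℕ → ℕ → ℕ → Code

mutual
  trT : Act → Act → Act → ℕ → ℕ → Ty → Ty
  trT vs vb va ks ka (atom n) = atom n
  trT vs vb va ks ka (A ⊃ B) = trT vs vb va ks ka A ⊃ trT vs vb va ks ka B
  trT vs vb va ks ka (⟦ s ⟧ A) = ⟦ trC vs vb va ks ka s ⟧ trT vs vb va ks ka A

  trC : Act → Act → Act → ℕ → ℕ → Code → Code
  trC vs vb va ks ka (svar i) = vs ks ka i
  trC vs vb va ks ka (avar i) = va ks ka i
  trC vs vb va ks ka (lam A s) = lam (trT vs vb va ks ka A) (trC vs vb va (suc ks) ka s)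
  trC vs vb va ks ka (app s t) = app (trC vs vb va ks ka s) (trC vs vb va ks ka t)
  trC vs vb va ks ka (box s) = box (trC vb vb va ks ka s)
  trC vs vb va ks ka (letB A s t) =
    letB (trT vs vb va ks ka A) (trC vs vb va ks ka s) (trC vs vb va ks (suc ka) t)
  trC vs vb va ks ka (TI θ) = TI (trL vs vb va ks ka θ)

  trM : Act → Act → Act → ℕ → ℕ → Maybe Code → Maybe Code
  trM vs vb va ks ka nothing = nothing
  trM vs vb va ks ka (just s) = just (trC vs vb va ks ka s)

  trL : Act → Act → Act → ℕ → ℕ → LMap Code → LMap Code
  trL vs vb va ks ka (lmap a b c d e f g h i j k) =
    lmap (trM vs vb va ks ka a) (trM vs vb va ks ka b) (trM vs vb va ks ka c)
         (trM vs vb va ks ka d) (trM vs vb va ks ka e) (trM vs vb va ks ka f)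
         (trM vs vb va ks ka g) (trM vs vb va ks ka h) (trM vs vb va ks ka i)
         (trM vs vb va ks ka j) (trM vs vb va ks ka k)

idS : Act
idS ks ka i = svar i

idA : Act
idA ks ka i = avar i

-- weakening (shift of free indices by n) for each sort; enters boxes
shS : ℕ → Act
shS n ks ka i = svar (if i <ᵇ ks then i else i + n)

shA : ℕ → Act
shA n ks ka i = avar (if i <ᵇ ka then i else i + n)

wkS : ℕ → Code → Code
wkS n = trC (shS n) (shS n) idA 0 0

wkA : ℕ → Code → Code
wkA n = trC idS idS (shA n) 0 0

wkSᵀ : ℕ → Ty → Ty
wkSᵀ n = trT (shS n) (shS n) idA 0 0

wkAᵀ : ℕ → Ty → Ty
wkAᵀ n = trT idS idS (shA n) 0 0

-- substitution of t for the simple variable with index k (capture avoiding).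
-- It does not enter boxes: inside a box only the indices of the other
-- (outer) simple variables are renumbered, as the binder disappears.
subSAct : ℕ → Code → Act
subSAct k t ks ka i =
  if i <ᵇ (k + ks) then svar i
  else (if i ≡ᵇ (k + ks) then wkA ka (wkS ks t) else svar (pred i))

subSBox : ℕ → Act
subSBox k ks ka i = if (k + ks) <ᵇ i then svar (pred i) else svar i

_[_/s_] : Code → Code → ℕ → Code
s [ t /s k ] = trC (subSAct k t) (subSBox k) idA 0 0 s

_[_/sᵀ_] : Ty → Code → ℕ → Ty
A [ t /sᵀ k ] = trT (subSAct k t) (subSBox k) idA 0 0 A

-- substitution of t for the audited variable with index k; enters everything
subAAct : ℕ → Code → Act
subAAct k t ks ka i =
  if i <ᵇ (k + ka) then avar i
  else (if i ≡ᵇ (k + ka) then wkA ka (wkS ks t) else avar (pred i))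

_[_/a_] : Code → Code → ℕ → Code
s [ t /a k ] = trC idS idS (subAAct k t) 0 0 s

_[_/aᵀ_] : Ty → Code → ℕ → Ty
A [ t /aᵀ k ] = trT idS idS (subAAct k t) 0 0 A

-- fallback used only when d ∉ dom θ (never the case for well-typed trails)
dflt : LMap Code → Code
dflt θ = fromMaybe (TI θ) (θ ⟨ ψd ⟩)

un : LMap Code → Label → Code
un θ ψ with θ ⟨ ψ ⟩
... | just c = c
... | nothing = dflt θ

uno : LMap Code → Label → Code → Code
uno θ ψ x with θ ⟨ ψ ⟩
... | just c = app c x
... | nothing = dflt θ

bin : LMap Code → Label → Code → Code → Code
bin θ ψ x y with θ ⟨ ψ ⟩
... | just c = app (app c x) y
... | nothing = dflt θ

mutual
  _∙_ : Trail → LMap Code → Code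
  tRefl _ ∙ θ = un θ ψrefl
  tTrans q₁ q₂ ∙ θ = bin θ ψtrans (q₁ ∙ θ) (q₂ ∙ θ)
  tβ _ _ _ ∙ θ = un θ ψβ
  tβ□ _ _ _ ∙ θ = un θ ψβ□
  tTi _ _ ∙ θ = un θ ψti
  tLam _ q ∙ θ = uno θ ψlam (q ∙ θ)
  tApp q₁ q₂ ∙ θ = bin θ ψapp (q₁ ∙ θ) (q₂ ∙ θ)
  tLet q₁ _ q₂ ∙ θ = bin θ ψlet (q₁ ∙ θ) (q₂ ∙ θ)
  tTrpl ζ ∙ θ = trplApp ζ θ

  trplApp : List (Label × Trail) → LMap Code → Code
  trplApp [] θ = un θ ψtrpl[]
  trplApp ((ψ , q) ∷ ζ) θ = bin θ ψtrpl∷ (q ∙ θ) (trplApp ζ θ)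

lookupZ : List (Label × Trail) → Label → Maybe Trail
lookupZ [] ψ = nothing
lookupZ ((ψ' , q) ∷ ζ) ψ = if labelIdx ψ' ≡ᵇ labelIdx ψ then just q else lookupZ ζ ψ

mutual
  src : Trail → Code
  src (tRefl s) = s
  src (tTrans q₁ q₂) = src q₁
  src (tβ A s t) = app (lam A s) t
  src (tβ□ s A t) = letB A (box s) t
  src (tTi q θ) = TI θ
  src (tLam A q) = lam A (src q)
  src (tApp q₁ q₂) = app (src q₁) (src q₂)
  src (tLet q₁ A q₂) = letB A (src q₁) (src q₂)
  src (tTrpl ζ) = TI (srcZ ζ)

  srcZ : List (Label × Trail) → LMap Code
  srcZ [] = emptyL
  srcZ ((ψ , q) ∷ ζ) = setL ψ (src q) (srcZ ζ)

mutual
  tgt : Trail → Code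
  tgt (tRefl s) = s
  tgt (tTrans q₁ q₂) = tgt q₂
  tgt (tβ A s t) = s [ t /s 0 ]
  tgt (tβ□ s A t) = t [ s /a 0 ]
  tgt (tTi q θ) = q ∙ θ
  tgt (tLam A q) = lam A (tgt q)
  tgt (tApp q₁ q₂) = app (tgt q₁) (tgt q₂)
  tgt (tLet q₁ A q₂) = letB A (tgt q₁) (tgt q₂)
  tgt (tTrpl ζ) = TI (tgtZ ζ)

  tgtZ : List (Label × Trail) → LMap Code
  tgtZ [] = emptyL
  tgtZ ((ψ , q) ∷ ζ) = setL ψ (tgt q) (tgtZ ζ)

𝒯 : Ty → Label → Ty
𝒯 B ψlam = B ⊃ B
𝒯 B ψtrans = B ⊃ B ⊃ B
𝒯 B ψapp = B ⊃ B ⊃ B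
𝒯 B ψlet = B ⊃ B ⊃ B
𝒯 B ψtrpl∷ = B ⊃ B ⊃ B
𝒯 B _ = B

-- Contexts.  Δ and Γ are lists of types (index 0 = most recent
-- declaration); all types in the contexts live in the current scope, so
-- extending a context weakens every type in both contexts.

Ctx : Set
Ctx = List Ty

_!!_ : {X : Set} → List X → ℕ → Maybe X
[] !! _ = nothing
(x ∷ xs) !! zero = just x
(x ∷ xs) !! suc i = xs !! i

extSΔ : Ctx → Ctx
extSΔ Δ = map (wkSᵀ 1) Δ

extSΓ : Ctx → Ty → Ctx
extSΓ Γ A = map (wkSᵀ 1) (A ∷ Γ)

extAΔ : Ctx → Ty → Ctx
extAΔ Δ A = map (wkAᵀ 1) (A ∷ Δ)

extAΓ : Ctx → Ctx
extAΓ Γ = map (wkAᵀ 1) Γ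

infix 4 _⨾_⊢_∶_
mutual
  data _⨾_⊢_∶_ : Ctx → Ctx → Code → Ty → Set where
    ⊢svar : ∀ {Δ Γ i A} → Γ !! i ≡ just A → Δ ⨾ Γ ⊢ svar i ∶ A
    ⊢avar : ∀ {Δ Γ i A} → Δ !! i ≡ just A → Δ ⨾ Γ ⊢ avar i ∶ A
    ⊢lam  : ∀ {Δ Γ A B s} → extSΔ Δ ⨾ extSΓ Γ A ⊢ s ∶ wkSᵀ 1 B →
            Δ ⨾ Γ ⊢ lam A s ∶ A ⊃ B
    ⊢app  : ∀ {Δ Γ A B s t} → Δ ⨾ Γ ⊢ s ∶ A ⊃ B → Δ ⨾ Γ ⊢ t ∶ A →
            Δ ⨾ Γ ⊢ app s t ∶ B
    ⊢box  : ∀ {Δ Γ A t} → Δ ⨾ [] ⊢ t ∶ A → Δ ⨾ Γ ⊢ box t ∶ ⟦ t ⟧ A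
    ⊢let  : ∀ {Δ Γ A C r s t} → Δ ⨾ Γ ⊢ s ∶ ⟦ r ⟧ A →
            extAΔ Δ A ⨾ extAΓ Γ ⊢ t ∶ C →
            Δ ⨾ Γ ⊢ letB A s t ∶ C [ r /aᵀ 0 ]
    ⊢TI   : ∀ {Δ Γ B θ} → (∃ λ c → θ ⟨ ψd ⟩ ≡ just c) →
            (∀ ψ → PtC Δ B ψ (θ ⟨ ψ ⟩)) →
            Δ ⨾ Γ ⊢ TI θ ∶ B

  data PtC (Δ : Ctx) (B : Ty) (ψ : Label) : Maybe Code → Set where
    none : PtC Δ B ψ nothing
    some : ∀ {c} → Δ ⨾ [] ⊢ c ∶ 𝒯 B ψ → PtC Δ B ψ (just c)

infix 4 _⨾_⊢_∶_≐[_]_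
mutual
  data _⨾_⊢_∶_≐[_]_ : Ctx → Ctx → Trail → Code → Ty → Code → Set where
    ⊢refl  : ∀ {Δ Γ A s} → Δ ⨾ Γ ⊢ s ∶ A → Δ ⨾ Γ ⊢ tRefl s ∶ s ≐[ A ] s
    ⊢trans : ∀ {Δ Γ A r s t q₁ q₂} → Δ ⨾ Γ ⊢ q₁ ∶ r ≐[ A ] s →
             Δ ⨾ Γ ⊢ q₂ ∶ s ≐[ A ] t → Δ ⨾ Γ ⊢ tTrans q₁ q₂ ∶ r ≐[ A ] t
    ⊢β     : ∀ {Δ Γ A B s t} → extSΔ Δ ⨾ extSΓ Γ A ⊢ s ∶ wkSᵀ 1 B →
             Δ ⨾ Γ ⊢ t ∶ A →
             Δ ⨾ Γ ⊢ tβ A s t ∶ app (lam A s) t ≐[ B ] s [ t /s 0 ]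
    ⊢β□    : ∀ {Δ Γ A C s t} → Δ ⨾ [] ⊢ s ∶ A →
             extAΔ Δ A ⨾ extAΓ Γ ⊢ t ∶ C →
             Δ ⨾ Γ ⊢ tβ□ s A t ∶ letB A (box s) t ≐[ C [ s /aᵀ 0 ] ] t [ s /a 0 ]
    ⊢ti    : ∀ {Δ Γ A B s t q θ} → (∃ λ c → θ ⟨ ψd ⟩ ≡ just c) →
             Δ ⨾ [] ⊢ q ∶ s ≐[ A ] t →
             (∀ ψ → PtC Δ B ψ (θ ⟨ ψ ⟩)) →
             Δ ⨾ Γ ⊢ tTi q θ ∶ TI θ ≐[ B ] q ∙ θ
    ⊢lam   : ∀ {Δ Γ A B s t q} → extSΔ Δ ⨾ extSΓ Γ A ⊢ q ∶ s ≐[ wkSᵀ 1 B ] t →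
             Δ ⨾ Γ ⊢ tLam A q ∶ lam A s ≐[ A ⊃ B ] lam A t
    ⊢app   : ∀ {Δ Γ A B s₁ s₂ t₁ t₂ q₁ q₂} →
             Δ ⨾ Γ ⊢ q₁ ∶ s₁ ≐[ A ⊃ B ] t₁ → Δ ⨾ Γ ⊢ q₂ ∶ s₂ ≐[ A ] t₂ →
             Δ ⨾ Γ ⊢ tApp q₁ q₂ ∶ app s₁ s₂ ≐[ B ] app t₁ t₂
    ⊢let   : ∀ {Δ Γ A C r s₁ s₂ t₁ t₂ q₁ q₂} →
             Δ ⨾ Γ ⊢ q₁ ∶ s₁ ≐[ ⟦ r ⟧ A ] t₁ →
             extAΔ Δ A ⨾ extAΓ Γ ⊢ q₂ ∶ s₂ ≐[ C ] t₂ →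
             Δ ⨾ Γ ⊢ tLet q₁ A q₂ ∶ letB A s₁ s₂ ≐[ C [ r /aᵀ 0 ] ] letB A t₁ t₂
    ⊢trpl  : ∀ {Δ Γ B ζ θ θ'} → Unique (map proj₁ ζ) →
             (∃ λ q → lookupZ ζ ψd ≡ just q) →
             (∀ ψ → PtT Δ B ψ (lookupZ ζ ψ) (θ ⟨ ψ ⟩) (θ' ⟨ ψ ⟩)) →
             Δ ⨾ Γ ⊢ tTrpl ζ ∶ TI θ ≐[ B ] TI θ'

  -- pointwise condition for trpl: dom ζ = dom θ = dom θ', and on the
  -- domain  Δ;· ⊢ ζ(ψ) : θ(ψ) ≐ θ'(ψ) at type 𝒯^B(ψ)
  data PtT (Δ : Ctx) (B : Ty) (ψ : Label) : Maybe Trail → Maybe Code → Maybe Code → Set where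
    none : PtT Δ B ψ nothing nothing nothing
    some : ∀ {q s t} → Δ ⨾ [] ⊢ q ∶ s ≐[ 𝒯 B ψ ] t → PtT Δ B ψ (just q) (just s) (just t)

WellTyped : Trail → Set
WellTyped q = Σ Ctx λ Δ → Σ Ctx λ Γ → Σ Ty λ A → Σ Code λ s' → Σ Code λ t' →
              Δ ⨾ Γ ⊢ q ∶ s' ≐[ A ] t'

_⇝_ : Code → Code → Set
s ⇝ t = Σ Trail λ q → WellTyped q × (src q ≡ s) × (tgt q ≡ t)

NormalForm : Code → Set
NormalForm s = ¬ (Σ Code λ t → (t ≢ s) × (s ⇝ t))

-- A typing derivation Δ;Γ ⊢ q : s ≐ t determines the endpoints of q: src q = s and tgt q = t.
-- Hence a typed trail from s to t ≠ s is itself a reduction s ⇝ t, contradicting normality of s.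
module Submission where

open import Defs
open import Data.Bool using (true; false; if_then_else_)
open import Data.List using (List; []; _∷_)
open import Data.Maybe using (Maybe; just; nothing) renaming (map to mapMaybe)
open import Data.Nat using (_≡ᵇ_)
open import Data.Product using (Σ; _,_; proj₁; proj₂; _×_)
open import Function using (_∘_)
open import Relation.Binary.PropositionalEquality using (_≡_; _≢_; refl; cong; cong₂; sym; trans)
open import Relation.Nullary using (¬_)

tabulateL : {X : Set} → (Label → Maybe X) → LMap X
tabulateL f = lmap (f ψrefl) (f ψtrans) (f ψβ) (f ψβ□) (f ψti) (f ψlam)
                   (f ψapp) (f ψlet) (f ψtrpl[]) (f ψtrpl∷) (f ψd)

lookup-tabulateL : {X : Set} (f : Label → Maybe X) (ψ : Label) → tabulateL f ⟨ ψ ⟩ ≡ f ψ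
lookup-tabulateL f ψrefl = refl
lookup-tabulateL f ψtrans = refl
lookup-tabulateL f ψβ = refl
lookup-tabulateL f ψβ□ = refl
lookup-tabulateL f ψti = refl
lookup-tabulateL f ψlam = refl
lookup-tabulateL f ψapp = refl
lookup-tabulateL f ψlet = refl
lookup-tabulateL f ψtrpl[] = refl
lookup-tabulateL f ψtrpl∷ = refl
lookup-tabulateL f ψd = refl

LMap-ext : {X : Set} (m m' : LMap X) → (∀ ψ → m ⟨ ψ ⟩ ≡ m' ⟨ ψ ⟩) → m ≡ m'
LMap-ext (lmap a b c d e f g h i j k) (lmap a' b' c' d' e' f' g' h' i' j' k') eq
  with eq ψrefl | eq ψtrans | eq ψβ | eq ψβ□ | eq ψti | eq ψlam
     | eq ψapp | eq ψlet | eq ψtrpl[] | eq ψtrpl∷ | eq ψd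
... | refl | refl | refl | refl | refl | refl | refl | refl | refl | refl | refl = refl

setL-tabulate : {X : Set} (ψ' : Label) (x : X) (m : LMap X) →
  setL ψ' x m ≡ tabulateL (λ ψ → if labelIdx ψ' ≡ᵇ labelIdx ψ then just x else m ⟨ ψ ⟩)
setL-tabulate ψrefl x (lmap _ _ _ _ _ _ _ _ _ _ _) = refl
setL-tabulate ψtrans x (lmap _ _ _ _ _ _ _ _ _ _ _) = refl
setL-tabulate ψβ x (lmap _ _ _ _ _ _ _ _ _ _ _) = refl
setL-tabulate ψβ□ x (lmap _ _ _ _ _ _ _ _ _ _ _) = refl
setL-tabulate ψti x (lmap _ _ _ _ _ _ _ _ _ _ _) = refl
setL-tabulate ψlam x (lmap _ _ _ _ _ _ _ _ _ _ _) = refl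
setL-tabulate ψapp x (lmap _ _ _ _ _ _ _ _ _ _ _) = refl
setL-tabulate ψlet x (lmap _ _ _ _ _ _ _ _ _ _ _) = refl
setL-tabulate ψtrpl[] x (lmap _ _ _ _ _ _ _ _ _ _ _) = refl
setL-tabulate ψtrpl∷ x (lmap _ _ _ _ _ _ _ _ _ _ _) = refl
setL-tabulate ψd x (lmap _ _ _ _ _ _ _ _ _ _ _) = refl

lookup-setL : {X : Set} (ψ' : Label) (x : X) (m : LMap X) (ψ : Label) →
  setL ψ' x m ⟨ ψ ⟩ ≡ (if labelIdx ψ' ≡ᵇ labelIdx ψ then just x else m ⟨ ψ ⟩)
lookup-setL {X} ψ' x m ψ = trans (cong (_⟨ ψ ⟩) (setL-tabulate ψ' x m)) (lookup-tabulateL updated ψ)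
  where
  updated : Label → Maybe X
  updated ψ'' = if labelIdx ψ' ≡ᵇ labelIdx ψ'' then just x else m ⟨ ψ'' ⟩

-- srcZ and tgtZ both build an LMap from ζ by successive setL; this is their common specification.
lookup-setL-fold : (f : Trail → Code) (F : List (Label × Trail) → LMap Code) →
  F [] ≡ emptyL → (∀ ψ q ζ → F ((ψ , q) ∷ ζ) ≡ setL ψ (f q) (F ζ)) →
  ∀ ζ ψ → F ζ ⟨ ψ ⟩ ≡ mapMaybe f (lookupZ ζ ψ)
lookup-setL-fold f F F[] F∷ [] ψ =
  trans (cong (_⟨ ψ ⟩) F[]) (lookup-tabulateL (λ _ → nothing) ψ)
lookup-setL-fold f F F[] F∷ ((ψ' , q) ∷ ζ) ψ
  rewrite F∷ ψ' q ζ | lookup-setL ψ' (f q) (F ζ) ψ with labelIdx ψ' ≡ᵇ labelIdx ψ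
... | true = refl
... | false = lookup-setL-fold f F F[] F∷ ζ ψ

lookup-srcZ : ∀ ζ ψ → srcZ ζ ⟨ ψ ⟩ ≡ mapMaybe src (lookupZ ζ ψ)
lookup-srcZ = lookup-setL-fold src srcZ refl (λ _ _ _ → refl)

lookup-tgtZ : ∀ ζ ψ → tgtZ ζ ⟨ ψ ⟩ ≡ mapMaybe tgt (lookupZ ζ ψ)
lookup-tgtZ = lookup-setL-fold tgt tgtZ refl (λ _ _ _ → refl)

mutual
  src-tgt-⊢ : ∀ {Δ Γ q s A t} → Δ ⨾ Γ ⊢ q ∶ s ≐[ A ] t → (src q ≡ s) × (tgt q ≡ t)
  src-tgt-⊢ (⊢refl _) = refl , refl
  src-tgt-⊢ (⊢trans d e) = proj₁ (src-tgt-⊢ d) , proj₂ (src-tgt-⊢ e)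
  src-tgt-⊢ (⊢β _ _) = refl , refl
  src-tgt-⊢ (⊢β□ _ _) = refl , refl
  src-tgt-⊢ (⊢ti _ _ _) = refl , refl
  src-tgt-⊢ (⊢lam d) with src-tgt-⊢ d
  ... | refl , refl = refl , refl
  src-tgt-⊢ (⊢app d e) with src-tgt-⊢ d | src-tgt-⊢ e
  ... | refl , refl | refl , refl = refl , refl
  src-tgt-⊢ (⊢let d e) with src-tgt-⊢ d | src-tgt-⊢ e
  ... | refl , refl | refl , refl = refl , refl
  src-tgt-⊢ (⊢trpl {ζ = ζ} _ _ pts) =
    cong TI (LMap-ext _ _ λ ψ → trans (lookup-srcZ ζ ψ) (proj₁ (src-tgt-PtT (pts ψ)))) ,
    cong TI (LMap-ext _ _ λ ψ → trans (lookup-tgtZ ζ ψ) (proj₂ (src-tgt-PtT (pts ψ))))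

  src-tgt-PtT : ∀ {Δ B ψ mq ms mt} → PtT Δ B ψ mq ms mt →
    (mapMaybe src mq ≡ ms) × (mapMaybe tgt mq ≡ mt)
  src-tgt-PtT none = refl , refl
  src-tgt-PtT (some d) = cong just (proj₁ (src-tgt-⊢ d)) , cong just (proj₂ (src-tgt-⊢ d))

⊢⇒⇝ : ∀ {Δ Γ q s A t} → Δ ⨾ Γ ⊢ q ∶ s ≐[ A ] t → s ⇝ t
⊢⇒⇝ {Δ} {Γ} {q} {s} {A} {t} d = q , (Δ , Γ , A , s , t , d) , src-tgt-⊢ d

mainTheorem1 : (s t : Code) → NormalForm s → NormalForm t → s ≢ t →
    ¬ (Σ Ctx λ Δ → Σ Ctx λ Γ → Σ Trail λ q → Σ Ty λ A → Δ ⨾ Γ ⊢ q ∶ s ≐[ A ] t)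
mainTheorem1 s t s-normal _ s≢t (_ , _ , _ , _ , d) = s-normal (t , s≢t ∘ sym , ⊢⇒⇝ d)
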